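{- For $n\ge1$ let $\phi(n)=|\tau(\mathbf{t}^<_{n-1})0|+1$. If $\rho(n)=3$, then $\rho(\phi(n))=3$.
   Context: Let $\tau$ be the morphism on $\{0,1,2\}^*$ given by $0\mapsto 01$, $1\mapsto 02$, $2\mapsto 0$, and let $\mathbf{t}=\lim_{n\to\infty}\tau^n(0)$ be its fixed point (the Tribonacci word). $\rho(n)$ is the number of distinct Parikh vectors $(|u|_0,|u|_1,|u|_2)$ of factors $u$ of $\mathbf{t}$ of length $n$ ($|u|_a$ = number of occurrences of $a$ in $u$). A factor $u$ is right special if $ua$ and $ub$ are factors for two distinct letters $a,b$; it is known that for each $n\ge1$, $\mathbf{t}$ has exactly one right special factor of length $n-1$, denoted $\mathbf{t}^<_{n-1}$. -}

module Defs where

open import Data.Nat using (ℕ; zero; suc; _+_)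
open import Data.List using (List; []; _∷_; _++_; length; map; upTo; concatMap)
open import Data.Product using (Σ; ∃; ∃-syntax; _×_; _,_)
open import Data.List.Membership.Propositional using (_∈_)
open import Data.List.Relation.Unary.Unique.Propositional using (Unique)
open import Relation.Binary.PropositionalEquality using (_≡_; _≢_)
open import Function.Bundles using (_⇔_)

data Letter : Set where
  l0 l1 l2 : Letter

Word : Set
Word = List Letter

τₗ : Letter → Word
τₗ l0 = l0 ∷ l1 ∷ []
τₗ l1 = l0 ∷ l2 ∷ []
τₗ l2 = l0 ∷ []

τ : Word → Word
τ = concatMap τₗ

τ^ : ℕ → Word
τ^ zero    = l0 ∷ []
τ^ (suc k) = τ (τ^ k)

-- i-th letter of a word (0-based), with default l0 if out of range
nth : Word → ℕ → Letter
nth []       _       = l0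
nth (a ∷ _)  zero    = a
nth (_ ∷ w)  (suc i) = nth w i

-- the Tribonacci word t = lim τ^n(0), as a function ℕ → Letter.
-- τ^k(0) is a prefix of τ^(k+1)(0) and |τ^(i+1)(0)| > i, so the i-th
-- letter of t is the i-th letter of τ^(i+1)(0).
t : ℕ → Letter
t i = nth (τ^ (suc i)) i

window : ℕ → ℕ → Word
window i m = map (λ j → t (i + j)) (upTo m)

IsFactor : Word → Set
IsFactor u = ∃[ i ] (u ≡ window i (length u))

count : Letter → Word → ℕ
count a [] = 0
count l0 (l0 ∷ w) = suc (count l0 w)
count l1 (l1 ∷ w) = suc (count l1 w)
count l2 (l2 ∷ w) = suc (count l2 w)
count a  (_ ∷ w)  = count a w

Parikh : Set
Parikh = ℕ × ℕ × ℕ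

parikh : Word → Parikh
parikh u = count l0 u , count l1 u , count l2 u

IsParikhOfLength : ℕ → Parikh → Set
IsParikhOfLength n v = ∃[ u ] (IsFactor u × length u ≡ n × parikh u ≡ v)

-- "ρ(n) = k": the set of Parikh vectors of length-n factors has exactly
-- k elements, i.e. it is enumerated by a duplicate-free list of length k
ρ≡ : ℕ → ℕ → Set
ρ≡ n k = ∃[ xs ] (Unique xs × length xs ≡ k × (∀ v → (v ∈ xs ⇔ IsParikhOfLength n v)))

RightSpecial : Word → Set
RightSpecial u = ∃[ a ] ∃[ b ] (a ≢ b × IsFactor (u ++ a ∷ []) × IsFactor (u ++ b ∷ []))

-- A right special factor w extends by every letter: when w is nonempty it ends in 0, and its
-- ancestor under τ is strictly shorter and again right special. So ρ(|w|+1) = 3 means that every factor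
-- of length |w|+1 has the Parikh vector of some wc. A factor v of length |τ(w)0| + 1
-- desubstitutes as 0^i v = τ(z) 0^j with i, j ≤ 1 and z a factor, whence |v|₁ = |z|₀,
-- |v|₂ = |z|₁ and |v|₀ = |z| ± 1. Comparing z with the factors of length |w|+1 (its prefix
-- when z is long, an extension of it when z is short) shows that the Parikh vector of v
-- dominates that of τ(w)0 componentwise. Being one letter longer, v then has the vector of
-- τ(w)0c for a letter c, and the three words τ(w)0c are factors: they are τ(w2)0, τ(w0), τ(w1).

module Submission where

open import Defs
open import Data.Nat using (ℕ; zero; suc; _+_; _∸_; _≤_; _<_; z≤n; s≤s; _≤?_)
open import Data.Nat.Properties
open import Data.Nat.Induction using (<-wellFounded)
open import Data.Nat.Tactic.RingSolver using (solve-∀)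
open import Data.List using (List; []; _∷_; _++_; length; map; upTo; applyUpTo; take; drop; replicate; [_]; initLast; _∷ʳ′_)
open import Data.List.Properties using (++-assoc; ++-identityʳ; length-++; length-++-sucʳ; length-++-≤ˡ; ∷-injective; ∷-injectiveʳ; ∷ʳ-injective; ++-cancelˡ; take++drop≡id; length-take; map-applyUpTo)
open import Data.List.Membership.Propositional using (_∈_)
open import Data.List.Membership.Propositional.Properties using (∈-∃++; ∈-++⁻; ∈-++⁺ˡ; ∈-++⁺ʳ; ∈-map⁺; ∈-map⁻)
open import Data.List.Relation.Unary.Any using (here; there)
open import Data.List.Relation.Unary.All as All using (All; []; _∷_)
open import Data.List.Relation.Unary.All.Properties using (¬Any⇒All¬)
open import Data.List.Relation.Unary.AllPairs using ([]; _∷_)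
open import Data.List.Relation.Unary.Unique.Propositional using (Unique)
open import Data.List.Relation.Unary.Unique.Propositional.Properties using (map⁺)
open import Data.Product using (∃-syntax; _×_; _,_; proj₁; proj₂; map₂)
open import Data.Product.Properties using (≡-dec)
open import Data.Sum using (inj₁; inj₂)
open import Data.Empty using (⊥-elim)
open import Function.Bundles using (mk⇔; Equivalence)
open import Induction.WellFounded using (Acc; acc)
open import Relation.Binary.Definitions using (DecidableEquality)
open import Relation.Binary.PropositionalEquality hiding ([_])
open import Relation.Nullary using (yes; no)

module _ {A : Set} where

  take-length-++ : ∀ (xs ys : List A) → take (length xs) (xs ++ ys) ≡ xs
  take-length-++ []       ys = refl
  take-length-++ (x ∷ xs) ys = cong (x ∷_) (take-length-++ xs ys)

  drop-length-++ : ∀ (xs ys : List A) → drop (length xs) (xs ++ ys) ≡ ys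
  drop-length-++ []       ys = refl
  drop-length-++ (x ∷ xs) ys = drop-length-++ xs ys

  length-∷ʳ : ∀ (xs : List A) x → length (xs ++ [ x ]) ≡ suc (length xs)
  length-∷ʳ xs x = trans (length-++-sucʳ xs x []) (cong suc (cong length (++-identityʳ xs)))

  applyUpTo-cong< : ∀ {f g : ℕ → A} m → (∀ j → j < m → f j ≡ g j) → applyUpTo f m ≡ applyUpTo g m
  applyUpTo-cong< zero    f≡g = refl
  applyUpTo-cong< (suc m) f≡g = cong₂ _∷_ (f≡g 0 (s≤s z≤n)) (applyUpTo-cong< m (λ j j<m → f≡g (suc j) (s≤s j<m)))

  ∈-delete-middle : ∀ (as : List A) {bs} {y z : A} → y ≢ z → z ∈ as ++ y ∷ bs → z ∈ as ++ bs
  ∈-delete-middle as y≢z z∈ with ∈-++⁻ as z∈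
  ... | inj₁ z∈as          = ∈-++⁺ˡ z∈as
  ... | inj₂ (here refl)   = ⊥-elim (y≢z refl)
  ... | inj₂ (there z∈bs)  = ∈-++⁺ʳ as z∈bs

  distinct-length≤ : ∀ {xs ys : List A} → Unique ys → All (_∈ xs) ys → length ys ≤ length xs
  distinct-length≤ [] [] = z≤n
  distinct-length≤ {ys = y ∷ ys} (y≢ys ∷ uniq) (y∈xs ∷ ys⊆xs) with ∈-∃++ y∈xs
  ... | as , bs , refl = begin
    suc (length ys)         ≤⟨ s≤s (distinct-length≤ uniq (All.zipWith (λ (y≢z , z∈) → ∈-delete-middle as y≢z z∈) (y≢ys , ys⊆xs))) ⟩
    suc (length (as ++ bs)) ≡⟨ length-++-sucʳ as y bs ⟨
    length (as ++ y ∷ bs)   ∎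
    where open ≤-Reasoning

  module _ (_≟_ : DecidableEquality A) where

    open import Data.List.Membership.DecPropositional _≟_ using (_∈?_)

    covered-by-distinct : ∀ {xs ys : List A} → Unique ys → All (_∈ xs) ys → length xs ≤ length ys →
                          ∀ {v} → v ∈ xs → v ∈ ys
    covered-by-distinct {ys = ys} uniq ys⊆xs short {v} v∈xs with v ∈? ys
    ... | yes v∈ys = v∈ys
    ... | no  v∉ys = ⊥-elim (<-irrefl refl (≤-trans (distinct-length≤ (¬Any⇒All¬ ys v∉ys ∷ uniq) (v∈xs ∷ ys⊆xs)) short))

count-++ : ∀ a u v → count a (u ++ v) ≡ count a u + count a v
count-++ a  []       v = refl
count-++ l0 (l0 ∷ u) v = cong suc (count-++ l0 u v)
count-++ l0 (l1 ∷ u) v = count-++ l0 u v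
count-++ l0 (l2 ∷ u) v = count-++ l0 u v
count-++ l1 (l0 ∷ u) v = count-++ l1 u v
count-++ l1 (l1 ∷ u) v = cong suc (count-++ l1 u v)
count-++ l1 (l2 ∷ u) v = count-++ l1 u v
count-++ l2 (l0 ∷ u) v = count-++ l2 u v
count-++ l2 (l1 ∷ u) v = count-++ l2 u v
count-++ l2 (l2 ∷ u) v = cong suc (count-++ l2 u v)

infixl 6 _⊕_
infix  4 _≼_

_⊕_ : Parikh → Parikh → Parikh
(a , b , c) ⊕ (a′ , b′ , c′) = a + a′ , b + b′ , c + c′

_≼_ : Parikh → Parikh → Set
(a , b , c) ≼ (a′ , b′ , c′) = a ≤ a′ × b ≤ b′ × c ≤ c′

total : Parikh → ℕ
total (a , b , c) = a + b + c

parikh-++ : ∀ u v → parikh (u ++ v) ≡ parikh u ⊕ parikh v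
parikh-++ u v = cong₂ _,_ (count-++ l0 u v) (cong₂ _,_ (count-++ l1 u v) (count-++ l2 u v))

length≡total : ∀ u → length u ≡ total (parikh u)
length≡total []       = refl
length≡total (l0 ∷ u) = cong suc (length≡total u)
length≡total (l1 ∷ u) = trans (cong suc (length≡total u)) (cong (_+ count l2 u) (sym (+-suc (count l0 u) (count l1 u))))
length≡total (l2 ∷ u) = trans (cong suc (length≡total u)) (sym (+-suc (count l0 u + count l1 u) (count l2 u)))

≼-trans : ∀ {p q r} → p ≼ q → q ≼ r → p ≼ r
≼-trans {_ , _ , _} {_ , _ , _} {_ , _ , _} (a≤ , b≤ , c≤) (a≤′ , b≤′ , c≤′) =
  ≤-trans a≤ a≤′ , ≤-trans b≤ b≤′ , ≤-trans c≤ c≤′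

≼-⊕ʳ : ∀ p q → p ≼ p ⊕ q
≼-⊕ʳ (a , b , c) (a′ , b′ , c′) = m≤m+n a a′ , m≤m+n b b′ , m≤m+n c c′

≼-++ʳ : ∀ u v → parikh u ≼ parikh (u ++ v)
≼-++ʳ u v = subst (parikh u ≼_) (sym (parikh-++ u v)) (≼-⊕ʳ (parikh u) (parikh v))

unit-vector : ∀ x y z → x + y + z ≡ 1 → ∃[ c ] (x , y , z) ≡ parikh [ c ]
unit-vector 1 0 0 refl = l0 , refl
unit-vector 0 1 0 refl = l1 , refl
unit-vector 0 0 1 refl = l2 , refl
unit-vector 0 0 0 ()
unit-vector 0 0 (suc (suc _)) ()
unit-vector 0 1 (suc _) ()
unit-vector 0 (suc (suc _)) _ ()
unit-vector 1 0 (suc _) ()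
unit-vector 1 (suc _) _ ()
unit-vector (suc (suc _)) _ _ ()

excess≡1 : ∀ a b c x y z → a + x + (b + y) + (c + z) ≡ suc (a + b + c) → x + y + z ≡ 1
excess≡1 a b c x y z sum≡ = +-cancelˡ-≡ (a + b + c) _ _ (begin
  a + b + c + (x + y + z)    ≡⟨ regroup a b c x y z ⟩
  a + x + (b + y) + (c + z)  ≡⟨ sum≡ ⟩
  suc (a + b + c)            ≡⟨ +-comm 1 (a + b + c) ⟩
  a + b + c + 1              ∎)
  where
    open ≡-Reasoning
    regroup : ∀ a b c x y z → a + b + c + (x + y + z) ≡ a + x + (b + y) + (c + z)
    regroup = solve-∀

≼-step : ∀ {p q} → p ≼ q → total q ≡ suc (total p) → ∃[ c ] q ≡ p ⊕ parikh [ c ]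
≼-step {a , b , c} {_ , _ , _} (a≤ , b≤ , c≤) total≡
  with x , refl ← m≤n⇒∃[o]m+o≡n a≤ | y , refl ← m≤n⇒∃[o]m+o≡n b≤ | z , refl ← m≤n⇒∃[o]m+o≡n c≤
  with d , xyz≡d ← unit-vector x y z (excess≡1 a b c x y z total≡)
  = d , cong ((a , b , c) ⊕_) xyz≡d

⊕-cancelˡ : ∀ p {q r} → p ⊕ q ≡ p ⊕ r → q ≡ r
⊕-cancelˡ (a , b , c) {_ , _ , _} {_ , _ , _} e =
  cong₂ _,_ (+-cancelˡ-≡ a _ _ (cong proj₁ e))
    (cong₂ _,_ (+-cancelˡ-≡ b _ _ (cong (λ p → proj₁ (proj₂ p)) e)) (+-cancelˡ-≡ c _ _ (cong (λ p → proj₂ (proj₂ p)) e)))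

parikh-[]-injective : ∀ {a b} → parikh [ a ] ≡ parikh [ b ] → a ≡ b
parikh-[]-injective {l0} {l0} _ = refl
parikh-[]-injective {l1} {l1} _ = refl
parikh-[]-injective {l2} {l2} _ = refl
parikh-[]-injective {l0} {l1} ()
parikh-[]-injective {l0} {l2} ()
parikh-[]-injective {l1} {l0} ()
parikh-[]-injective {l1} {l2} ()
parikh-[]-injective {l2} {l0} ()
parikh-[]-injective {l2} {l1} ()

parikh-∷ʳ-injective : ∀ u {a b} → parikh (u ++ [ a ]) ≡ parikh (u ++ [ b ]) → a ≡ b
parikh-∷ʳ-injective u {a} {b} e = parikh-[]-injective (⊕-cancelˡ (parikh u)
  (trans (sym (parikh-++ u [ a ])) (trans e (parikh-++ u [ b ]))))

parikh-τ-++ : ∀ u s → parikh (τ u ++ s) ≡ (length u , count l0 u , count l1 u) ⊕ parikh s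
parikh-τ-++ []       s = refl
parikh-τ-++ (l0 ∷ u) s = cong (λ (a , b , c) → suc a , suc b , c) (parikh-τ-++ u s)
parikh-τ-++ (l1 ∷ u) s = cong (λ (a , b , c) → suc a , b , suc c) (parikh-τ-++ u s)
parikh-τ-++ (l2 ∷ u) s = cong (λ (a , b , c) → suc a , b , c) (parikh-τ-++ u s)

parikh-replicate-l0 : ∀ i → parikh (replicate i l0) ≡ (i , 0 , 0)
parikh-replicate-l0 zero    = refl
parikh-replicate-l0 (suc i) = cong (λ (a , b , c) → suc a , b , c) (parikh-replicate-l0 i)

-- ρ = 3 through the three one-letter extensions of a word

letters : List Letter
letters = l0 ∷ l1 ∷ l2 ∷ []

∈-letters : ∀ c → c ∈ letters
∈-letters l0 = here refl
∈-letters l1 = there (here refl)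
∈-letters l2 = there (there (here refl))

letters-unique : Unique letters
letters-unique = ((λ ()) ∷ (λ ()) ∷ []) ∷ ((λ ()) ∷ []) ∷ [] ∷ []

ExtendsByAll : Word → Set
ExtendsByAll u = ∀ c → IsFactor (u ++ [ c ])

ExtensionsCover : Word → Set
ExtensionsCover u = ∀ v → IsFactor v → length v ≡ suc (length u) → ∃[ c ] parikh v ≡ parikh (u ++ [ c ])

module _ (u : Word) (extends : ExtendsByAll u) where

  private
    extend : Letter → Parikh
    extend c = parikh (u ++ [ c ])

    extensions : List Parikh
    extensions = map extend letters

    extensions-unique : Unique extensions
    extensions-unique = map⁺ (parikh-∷ʳ-injective u) letters-unique

    extension-realised : ∀ {v} → v ∈ extensions → IsParikhOfLength (suc (length u)) v
    extension-realised v∈ with c , _ , refl ← ∈-map⁻ extend v∈ = u ++ [ c ] , extends c , length-∷ʳ u c , refl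

  ρ≡3⇒extensionsCover : ρ≡ (suc (length u)) 3 → ExtensionsCover u
  ρ≡3⇒extensionsCover (xs , _ , length≡3 , xs⇔) v v-factor v-length
    with c , _ , v≡ ← ∈-map⁻ extend (covered-by-distinct (≡-dec _≟_ (≡-dec _≟_ _≟_)) extensions-unique
                                (All.tabulate (λ v∈ → Equivalence.from (xs⇔ _) (extension-realised v∈)))
                                (≤-reflexive length≡3)
                                (Equivalence.from (xs⇔ (parikh v)) (v , v-factor , v-length , refl)))
    = c , v≡

  extensionsCover⇒ρ≡3 : ExtensionsCover u → ρ≡ (suc (length u)) 3
  extensionsCover⇒ρ≡3 cover = extensions , extensions-unique , refl , λ v → mk⇔ extension-realised covered
    where
      covered : ∀ {v} → IsParikhOfLength (suc (length u)) v → v ∈ extensions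
      covered (v , v-factor , v-length , refl) with c , v≡ ← cover v v-factor v-length =
        subst (_∈ extensions) (sym v≡) (∈-map⁺ extend (∈-letters c))

τ-++ : ∀ u v → τ (u ++ v) ≡ τ u ++ τ v
τ-++ []      v = refl
τ-++ (a ∷ u) v = trans (cong (τₗ a ++_) (τ-++ u v)) (sym (++-assoc (τₗ a) (τ u) (τ v)))

τ-∷ʳ : ∀ u c → τ (u ++ [ c ]) ≡ τ u ++ τₗ c
τ-∷ʳ u c = trans (τ-++ u [ c ]) (cong (τ u ++_) (++-identityʳ (τₗ c)))

τₗ-tail : Letter → Word
τₗ-tail l0 = [ l1 ]
τₗ-tail l1 = [ l2 ]
τₗ-tail l2 = []

τₗ≡l0∷tail : ∀ c → τₗ c ≡ l0 ∷ τₗ-tail c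
τₗ≡l0∷tail l0 = refl
τₗ≡l0∷tail l1 = refl
τₗ≡l0∷tail l2 = refl

τ^-grows : ∀ k → ∃[ b ] ∃[ r ] τ^ (suc k) ≡ τ^ k ++ b ∷ r
τ^-grows zero = l1 , [] , refl
τ^-grows (suc k) with b , r , eq ← τ^-grows k = l0 , τₗ-tail b ++ τ r , (begin
  τ (τ^ (suc k))                      ≡⟨ cong τ eq ⟩
  τ (τ^ k ++ b ∷ r)                   ≡⟨ τ-++ (τ^ k) (b ∷ r) ⟩
  τ^ (suc k) ++ τₗ b ++ τ r           ≡⟨ cong (λ q → τ^ (suc k) ++ q ++ τ r) (τₗ≡l0∷tail b) ⟩
  τ^ (suc k) ++ l0 ∷ τₗ-tail b ++ τ r ∎)
  where open ≡-Reasoning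

τ^-prefix : ∀ k j → ∃[ r ] τ^ (j + k) ≡ τ^ k ++ r
τ^-prefix k zero = [] , sym (++-identityʳ (τ^ k))
τ^-prefix k (suc j) with r , eq ← τ^-prefix k j | b , r′ , eq′ ← τ^-grows (j + k) =
  r ++ b ∷ r′ , trans eq′ (trans (cong (_++ b ∷ r′) eq) (++-assoc (τ^ k) r (b ∷ r′)))

length-τ^ : ∀ k → k < length (τ^ k)
length-τ^ zero = s≤s z≤n
length-τ^ (suc k) with b , r , eq ← τ^-grows k = begin-strict
  suc k                          <⟨ s≤s (length-τ^ k) ⟩
  suc (length (τ^ k))            ≤⟨ s≤s (length-++-≤ˡ (τ^ k)) ⟩
  suc (length (τ^ k ++ r))       ≡⟨ length-++-sucʳ (τ^ k) b r ⟨
  length (τ^ k ++ b ∷ r)         ≡⟨ cong length eq ⟨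
  length (τ^ (suc k))            ∎
  where open ≤-Reasoning

nth-++ : ∀ xs ys i → i < length xs → nth (xs ++ ys) i ≡ nth xs i
nth-++ (x ∷ xs) ys zero    _         = refl
nth-++ (x ∷ xs) ys (suc i) (s≤s i<) = nth-++ xs ys i i<

nth-τ^-stable : ∀ k j i → i < length (τ^ k) → nth (τ^ (j + k)) i ≡ nth (τ^ k) i
nth-τ^-stable k j i i< with r , eq ← τ^-prefix k j = trans (cong (λ W → nth W i) eq) (nth-++ (τ^ k) r i i<)

t≡nth-τ^ : ∀ k i → i < length (τ^ k) → t i ≡ nth (τ^ k) i
t≡nth-τ^ k i i< = begin
  nth (τ^ (suc i)) i      ≡⟨ nth-τ^-stable (suc i) k i (<-trans (n<1+n i) (length-τ^ (suc i))) ⟨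
  nth (τ^ (k + suc i)) i  ≡⟨ cong (λ m → nth (τ^ m) i) (+-comm k (suc i)) ⟩
  nth (τ^ (suc i + k)) i  ≡⟨ nth-τ^-stable k (suc i) i i< ⟩
  nth (τ^ k) i            ∎
  where open ≡-Reasoning

take-drop≡nth : ∀ W i m → i + m ≤ length W → take m (drop i W) ≡ applyUpTo (λ j → nth W (i + j)) m
take-drop≡nth W       i       zero    _         = refl
take-drop≡nth (a ∷ W) zero    (suc m) (s≤s m≤)  = cong (a ∷_) (take-drop≡nth W 0 m m≤)
take-drop≡nth (a ∷ W) (suc i) (suc m) (s≤s im≤) = take-drop≡nth W i (suc m) im≤

window≡slice : ∀ k i m → i + m ≤ length (τ^ k) → window i m ≡ take m (drop i (τ^ k))
window≡slice k i m im≤ = begin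
  map (λ j → t (i + j)) (upTo m)          ≡⟨ map-applyUpTo (λ j → j) (λ j → t (i + j)) m ⟩
  applyUpTo (λ j → t (i + j)) m           ≡⟨ applyUpTo-cong< m (λ j j<m → t≡nth-τ^ k (i + j) (<-≤-trans (+-monoʳ-< i j<m) im≤)) ⟩
  applyUpTo (λ j → nth (τ^ k) (i + j)) m  ≡⟨ take-drop≡nth (τ^ k) i m im≤ ⟨
  take m (drop i (τ^ k))                  ∎
  where open ≡-Reasoning

-- Factors as infixes of the prefixes τ^k(0)

Occurs : Word → Set
Occurs u = ∃[ k ] ∃[ x ] ∃[ y ] τ^ k ≡ x ++ u ++ y

occurs⇒isFactor : ∀ {u} → Occurs u → IsFactor u
occurs⇒isFactor {u} (k , x , y , eq) = length x , sym (begin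
  window (length x) (length u)                     ≡⟨ window≡slice k (length x) (length u) in-range ⟩
  take (length u) (drop (length x) (τ^ k))         ≡⟨ cong (λ W → take (length u) (drop (length x) W)) eq ⟩
  take (length u) (drop (length x) (x ++ u ++ y))  ≡⟨ cong (take (length u)) (drop-length-++ x (u ++ y)) ⟩
  take (length u) (u ++ y)                         ≡⟨ take-length-++ u y ⟩
  u                                                ∎)
  where
    open ≡-Reasoning
    in-range : length x + length u ≤ length (τ^ k)
    in-range = ≤-trans (+-monoʳ-≤ (length x) (length-++-≤ˡ u)) (≤-reflexive (sym (trans (cong length eq) (length-++ x))))

isFactor⇒occurs : ∀ {u} → IsFactor u → Occurs u
isFactor⇒occurs {u} (i , u≡) = K , take i W , drop m (drop i W) , (begin
  W                                                    ≡⟨ take++drop≡id i W ⟨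
  take i W ++ drop i W                                 ≡⟨ cong (take i W ++_) (take++drop≡id m (drop i W)) ⟨
  take i W ++ take m (drop i W) ++ drop m (drop i W)   ≡⟨ cong (λ v → take i W ++ v ++ drop m (drop i W)) slice≡u ⟩
  take i W ++ u ++ drop m (drop i W)                   ∎)
  where
    open ≡-Reasoning
    m K : ℕ
    m = length u
    K = i + m
    W : Word
    W = τ^ K
    slice≡u : take m (drop i W) ≡ u
    slice≡u = trans (sym (window≡slice K i m (<⇒≤ (length-τ^ K)))) (sym u≡)

occurs-++⁻ˡ : ∀ u v → Occurs (u ++ v) → Occurs u
occurs-++⁻ˡ u v (k , x , y , eq) = k , x , v ++ y , trans eq (cong (x ++_) (++-assoc u v y))

occurs-++⁻ʳ : ∀ u v → Occurs (u ++ v) → Occurs v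
occurs-++⁻ʳ u v (k , x , y , eq) =
  k , x ++ u , y , trans eq (trans (cong (x ++_) (++-assoc u v y)) (sym (++-assoc x u (v ++ y))))

occurs-τ : ∀ {u} → Occurs u → Occurs (τ u)
occurs-τ {u} (k , x , y , eq) = suc k , τ x , τ y , trans (cong τ eq) (trans (τ-++ x (u ++ y)) (cong (τ x ++_) (τ-++ u y)))

occurs-in-τ^suc : ∀ {u} → Occurs u → ∃[ k ] ∃[ x ] ∃[ y ] τ^ (suc k) ≡ x ++ u ++ y
occurs-in-τ^suc {u} (k , x , y , eq) with b , r , eq′ ← τ^-grows k =
  k , x , y ++ b ∷ r ,
  trans eq′ (trans (cong (_++ b ∷ r) eq) (trans (++-assoc x (u ++ y) (b ∷ r)) (cong (x ++_) (++-assoc u y (b ∷ r)))))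

occurs-∷ʳ : ∀ {u} → Occurs u → ∃[ c ] Occurs (u ++ [ c ])
occurs-∷ʳ {u} (k , x , c ∷ y , eq) = c , k , x , y , trans eq (cong (x ++_) (sym (++-assoc u [ c ] y)))
occurs-∷ʳ {u} (k , x , [] , eq) with b , r , eq′ ← τ^-grows k = b , suc k , x , r , (begin
  τ^ (suc k)                ≡⟨ eq′ ⟩
  τ^ k ++ b ∷ r             ≡⟨ cong (_++ b ∷ r) (trans eq (cong (x ++_) (++-identityʳ u))) ⟩
  (x ++ u) ++ b ∷ r         ≡⟨ ++-assoc x u (b ∷ r) ⟩
  x ++ u ++ b ∷ r           ≡⟨ cong (x ++_) (++-assoc u [ b ] r) ⟨
  x ++ (u ++ [ b ]) ++ r    ∎)
  where open ≡-Reasoning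

occurs-extend : ∀ m {z} → Occurs z → ∃[ s ] length s ≡ m × Occurs (z ++ s)
occurs-extend zero    {z} occ = [] , refl , subst Occurs (sym (++-identityʳ z)) occ
occurs-extend (suc m) {z} occ
  with c , occ′ ← occurs-∷ʳ occ
  with s , s-length , occ″ ← occurs-extend m occ′
  = c ∷ s , cong suc s-length , subst Occurs (++-assoc z [ c ] s) occ″

letter-occurs : ∀ c → Occurs [ c ]
letter-occurs l0 = 0 , [] , [] , refl
letter-occurs l1 = 1 , [ l0 ] , [] , refl
letter-occurs l2 = 2 , l0 ∷ l1 ∷ [ l0 ] , [] , refl

occurs-τ-∷ʳl0 : ∀ {u} → Occurs u → Occurs (τ u ++ [ l0 ])
occurs-τ-∷ʳl0 {u} occ with b , occ′ ← occurs-∷ʳ occ =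
  occurs-++⁻ˡ (τ u ++ [ l0 ]) (τₗ-tail b) (subst Occurs image≡ (occurs-τ occ′))
  where
    open ≡-Reasoning
    image≡ : τ (u ++ [ b ]) ≡ (τ u ++ [ l0 ]) ++ τₗ-tail b
    image≡ = begin
      τ (u ++ [ b ])               ≡⟨ τ-∷ʳ u b ⟩
      τ u ++ τₗ b                  ≡⟨ cong (τ u ++_) (τₗ≡l0∷tail b) ⟩
      τ u ++ l0 ∷ τₗ-tail b        ≡⟨ ++-assoc (τ u) [ l0 ] (τₗ-tail b) ⟨
      (τ u ++ [ l0 ]) ++ τₗ-tail b ∎

-- Desubstitution

τ-∷ : ∀ c u → τ (c ∷ u) ≡ l0 ∷ τₗ-tail c ++ τ u
τ-∷ c u = cong (_++ τ u) (τₗ≡l0∷tail c)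

τ-head : ∀ u {a r} → τ u ≡ a ∷ r → a ≡ l0
τ-head (l0 ∷ u) refl = refl
τ-head (l1 ∷ u) refl = refl
τ-head (l2 ∷ u) refl = refl

length-τ : ∀ u → length u ≤ length (τ u)
length-τ []       = z≤n
length-τ (l0 ∷ u) = s≤s (m≤n⇒m≤1+n (length-τ u))
length-τ (l1 ∷ u) = s≤s (m≤n⇒m≤1+n (length-τ u))
length-τ (l2 ∷ u) = s≤s (length-τ u)

τ-injective : ∀ u v → τ u ≡ τ v → u ≡ v
τ-injective []       []       _ = refl
τ-injective []       (l0 ∷ v) ()
τ-injective []       (l1 ∷ v) ()
τ-injective []       (l2 ∷ v) ()
τ-injective (l0 ∷ u) []       ()
τ-injective (l1 ∷ u) []       ()
τ-injective (l2 ∷ u) []       ()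
τ-injective (l0 ∷ u) (l0 ∷ v) e = cong (l0 ∷_) (τ-injective u v (++-cancelˡ (τₗ l0) _ _ e))
τ-injective (l1 ∷ u) (l1 ∷ v) e = cong (l1 ∷_) (τ-injective u v (++-cancelˡ (τₗ l1) _ _ e))
τ-injective (l2 ∷ u) (l2 ∷ v) e = cong (l2 ∷_) (τ-injective u v (++-cancelˡ (τₗ l2) _ _ e))
τ-injective (l0 ∷ u) (l1 ∷ v) ()
τ-injective (l1 ∷ u) (l0 ∷ v) ()
τ-injective (l0 ∷ u) (l2 ∷ v) e with () ← τ-head v (sym (∷-injectiveʳ e))
τ-injective (l1 ∷ u) (l2 ∷ v) e with () ← τ-head v (sym (∷-injectiveʳ e))
τ-injective (l2 ∷ u) (l0 ∷ v) e with () ← τ-head u (∷-injectiveʳ e)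
τ-injective (l2 ∷ u) (l1 ∷ v) e with () ← τ-head u (∷-injectiveʳ e)

data Cut (P x r : Word) : Set where
  boundary : ∀ P₁ P₂ → P ≡ P₁ ++ P₂ → x ≡ τ P₁ → r ≡ τ P₂ → Cut P x r
  inside   : ∀ P₁ c P₂ → c ≢ l2 → P ≡ P₁ ++ c ∷ P₂ → x ≡ τ P₁ ++ [ l0 ] → r ≡ τₗ-tail c ++ τ P₂ → Cut P x r

cut-∷ : ∀ c {P x r} → Cut P x r → Cut (c ∷ P) (τₗ c ++ x) r
cut-∷ c (boundary P₁ P₂ refl refl refl)     = boundary (c ∷ P₁) P₂ refl refl refl
cut-∷ c (inside P₁ d P₂ d≢2 refl refl refl) = inside (c ∷ P₁) d P₂ d≢2 refl (sym (++-assoc (τₗ c) (τ P₁) [ l0 ])) refl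

cut : ∀ P x r → x ++ r ≡ τ P → Cut P x r
cut P        []          r eq = boundary [] P refl refl eq
cut (l0 ∷ P) (_ ∷ [])    r eq with refl , eq′ ← ∷-injective eq = inside [] l0 P (λ ()) refl refl eq′
cut (l1 ∷ P) (_ ∷ [])    r eq with refl , eq′ ← ∷-injective eq = inside [] l1 P (λ ()) refl refl eq′
cut (l0 ∷ P) (_ ∷ _ ∷ x) r eq with refl , eq′ ← ∷-injective eq with refl , eq″ ← ∷-injective eq′ = cut-∷ l0 (cut P x r eq″)
cut (l1 ∷ P) (_ ∷ _ ∷ x) r eq with refl , eq′ ← ∷-injective eq with refl , eq″ ← ∷-injective eq′ = cut-∷ l1 (cut P x r eq″)
cut (l2 ∷ P) (_ ∷ x)     r eq with refl , eq′ ← ∷-injective eq = cut-∷ l2 (cut P x r eq′)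

occurs-cut : ∀ u v → Occurs (u ++ v) → ∃[ k ] ∃[ x ] ∃[ y ] Cut (τ^ k) (x ++ u) (v ++ y)
occurs-cut u v occ with k , x , y , eq ← occurs-in-τ^suc occ =
  k , x , y , cut (τ^ k) (x ++ u) (v ++ y)
                (sym (trans eq (trans (cong (x ++_) (++-assoc u v y)) (sym (++-assoc x u (v ++ y))))))

-- Right special factors extend by every letter

-- w is τ z, possibly with its leading 0 removed when z begins with 0 or 1.
data Ancestor (w : Word) : Word → Set where
  exact   : ∀ {z} → w ≡ τ z → Ancestor w z
  trimmed : ∀ {c u} → c ≢ l2 → w ≡ τₗ-tail c ++ τ u → Ancestor w (c ∷ u)

tail-not-image : ∀ {c} z u → c ≢ l2 → τ z ≢ τₗ-tail c ++ τ u
tail-not-image {l0} z u _   e with () ← τ-head z e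
tail-not-image {l1} z u _   e with () ← τ-head z e
tail-not-image {l2} z u c≢2 _ = c≢2 refl

ancestor-unique : ∀ {w z z′} → Ancestor w z → Ancestor w z′ → z ≡ z′
ancestor-unique {z = z} {z′} (exact e) (exact e′) = τ-injective z z′ (trans (sym e) e′)
ancestor-unique {z = z} (exact e) (trimmed {u = u} c≢2 e′) = ⊥-elim (tail-not-image z u c≢2 (trans (sym e) e′))
ancestor-unique {z′ = z′} (trimmed {u = u} c≢2 e) (exact e′) = ⊥-elim (tail-not-image z′ u c≢2 (trans (sym e′) e))
ancestor-unique (trimmed {c} {u} _ e) (trimmed {c′} {u′} _ e′) =
  τ-injective (c ∷ u) (c′ ∷ u′) (trans (τ-∷ c u) (trans (cong (l0 ∷_) (trans (sym e) e′)) (sym (τ-∷ c′ u′))))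

ancestor-length : ∀ {w z} → Ancestor w z → length z ≤ length w
ancestor-length {z = z} (exact refl) = length-τ z
ancestor-length (trimmed {l0} {u} _ refl) = s≤s (length-τ u)
ancestor-length (trimmed {l1} {u} _ refl) = s≤s (length-τ u)
ancestor-length (trimmed {l2} c≢2 _) = ⊥-elim (c≢2 refl)

ancestor-prefix : ∀ {w z} → Ancestor w z → ∃[ h ] τ z ≡ h ++ w
ancestor-prefix (exact e)            = [] , sym e
ancestor-prefix (trimmed {c} {u} _ e) = [ l0 ] , trans (τ-∷ c u) (cong (l0 ∷_) (sym e))

-- In an image τ P, an occurrence of 0d starts the block τₗ (block d) (followed by the next block's 0).
block : Letter → Letter
block l0 = l2
block l1 = l0
block l2 = l1

block-injective : ∀ {a b} → block a ≡ block b → a ≡ b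
block-injective {l0} {l0} _ = refl
block-injective {l1} {l1} _ = refl
block-injective {l2} {l2} _ = refl

block-image : ∀ d → ∃[ s ] τₗ (block d) ++ [ l0 ] ≡ l0 ∷ d ∷ s
block-image l0 = [] , refl
block-image l1 = [ l0 ] , refl
block-image l2 = [ l0 ] , refl

block-head : ∀ P {d y} → l0 ∷ d ∷ y ≡ τ P → ∃[ P′ ] P ≡ block d ∷ P′
block-head (l0 ∷ P′) refl = P′ , refl
block-head (l1 ∷ P′) refl = P′ , refl
block-head (l2 ∷ P′) e with refl ← τ-head P′ (sym (∷-injectiveʳ e)) = P′ , refl

preceded-by-l0 : ∀ u {e a} → a ≢ l0 → Occurs ((u ++ [ e ]) ++ [ a ]) → e ≡ l0
preceded-by-l0 u {e} {a} a≢0 occ with occurs-cut (u ++ [ e ]) [ a ] occ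
... | _ , _ , _ , boundary _ P₂ _ _ a∷y≡  = ⊥-elim (a≢0 (τ-head P₂ (sym a∷y≡)))
... | _ , x , _ , inside P₁ _ _ _ _ x≡ _ =
  proj₂ (∷ʳ-injective (x ++ u) (τ P₁) (trans (++-assoc x u [ e ]) x≡))

private
  reassoc : ∀ (a b : Word) c d → (a ++ b) ++ c ∷ d ≡ a ++ (b ++ [ c ]) ++ d
  reassoc a b c d = trans (++-assoc a b (c ∷ d)) (cong (a ++_) (sym (++-assoc b [ c ] d)))

desubstitute-l0∷ʳ : ∀ w d → Occurs (w ++ l0 ∷ d ∷ []) → ∃[ z ] Ancestor w z × Occurs (z ++ [ block d ])
desubstitute-l0∷ʳ w d occ with occurs-cut w (l0 ∷ d ∷ []) occ
... | _ , _ , _ , inside _ l0 _ _ _ _ ()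
... | _ , _ , _ , inside _ l1 _ _ _ _ ()
... | _ , _ , _ , inside _ l2 _ l2≢l2 _ _ _ = ⊥-elim (l2≢l2 refl)
... | k , x , _ , boundary P₁ P₂ P≡ x++w≡ 0d∷y≡
  with P′ , refl ← block-head P₂ 0d∷y≡
  with cut P₁ x w x++w≡
... | boundary Q₁ Q₂ refl _ w≡ =
  Q₂ , exact w≡ , k , Q₁ , P′ , trans P≡ (reassoc Q₁ Q₂ (block d) P′)
... | inside Q₁ c Q₂ c≢2 refl _ w≡ =
  c ∷ Q₂ , trimmed c≢2 w≡ , k , Q₁ , P′ , trans P≡ (reassoc Q₁ (c ∷ Q₂) (block d) P′)

ancestor-extends : ∀ {w z} d → Ancestor w z → Occurs (z ++ [ block d ]) → Occurs (w ++ l0 ∷ d ∷ [])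
ancestor-extends {w} {z} d anc occ with h , τz≡ ← ancestor-prefix anc | s , image≡ ← block-image d =
  occurs-++⁻ˡ _ s (occurs-++⁻ʳ h _ (subst Occurs occurrence (occurs-τ-∷ʳl0 occ)))
  where
    open ≡-Reasoning
    occurrence : τ (z ++ [ block d ]) ++ [ l0 ] ≡ h ++ (w ++ l0 ∷ d ∷ []) ++ s
    occurrence = begin
      τ (z ++ [ block d ]) ++ [ l0 ]    ≡⟨ cong (_++ [ l0 ]) (τ-∷ʳ z (block d)) ⟩
      (τ z ++ τₗ (block d)) ++ [ l0 ]   ≡⟨ ++-assoc (τ z) _ [ l0 ] ⟩
      τ z ++ τₗ (block d) ++ [ l0 ]     ≡⟨ cong₂ _++_ τz≡ image≡ ⟩
      (h ++ w) ++ l0 ∷ d ∷ s            ≡⟨ ++-assoc h w _ ⟩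
      h ++ w ++ l0 ∷ d ∷ s              ≡⟨ cong (h ++_) (++-assoc w (l0 ∷ d ∷ []) s) ⟨
      h ++ (w ++ l0 ∷ d ∷ []) ++ s      ∎

occurs-++-assoc : ∀ u {v x} → Occurs ((u ++ v) ++ x) → Occurs (u ++ v ++ x)
occurs-++-assoc u {v} {x} = subst Occurs (++-assoc u v x)

ends-in-l0 : ∀ u {e a b} → a ≢ b → Occurs ((u ++ [ e ]) ++ [ a ]) → Occurs ((u ++ [ e ]) ++ [ b ]) → e ≡ l0
ends-in-l0 u {a = l0} {l0} a≢b _ _   = ⊥-elim (a≢b refl)
ends-in-l0 u {a = l0} {l1} _   _ occ = preceded-by-l0 u (λ ()) occ
ends-in-l0 u {a = l0} {l2} _   _ occ = preceded-by-l0 u (λ ()) occ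
ends-in-l0 u {a = l1}      _ occ _   = preceded-by-l0 u (λ ()) occ
ends-in-l0 u {a = l2}      _ occ _   = preceded-by-l0 u (λ ()) occ

extends-by-all : ∀ w → Acc _<_ (length w) → ∀ {a b} → a ≢ b →
                 Occurs (w ++ [ a ]) → Occurs (w ++ [ b ]) → ∀ c → Occurs (w ++ [ c ])
extends-by-all w _ _ _ _ c with initLast w
... | [] = letter-occurs c
extends-by-all _ (acc shorter) {a} {b} a≢b wa wb c | u ∷ʳ′ e
  with refl ← ends-in-l0 u a≢b wa wb
  with z , anc-a , za ← desubstitute-l0∷ʳ u a (occurs-++-assoc u wa)
  with _ , anc-b , zb ← desubstitute-l0∷ʳ u b (occurs-++-assoc u wb)
  with refl ← ancestor-unique anc-b anc-a
  = subst Occurs (sym (++-assoc u [ l0 ] [ c ]))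
      (ancestor-extends c anc-a
        (extends-by-all z (shorter z<w) (λ ba≡bb → a≢b (block-injective ba≡bb)) za zb (block c)))
  where
    z<w : length z < length (u ++ [ l0 ])
    z<w = ≤-trans (s≤s (ancestor-length anc-a)) (≤-reflexive (sym (length-∷ʳ u l0)))

private
  desubstitute-prefix : ∀ {k} P R {u y} → τ^ k ≡ P ++ R → u ++ y ≡ τ R →
                        ∃[ z ] ∃[ j ] Occurs z × j ≤ 1 × u ≡ τ z ++ replicate j l0
  desubstitute-prefix {k} P R {u} {y} P≡ e with cut R u y e
  ... | boundary Q₁ Q₂ R≡ u≡ _   = Q₁ , 0 , (k , P , Q₂ , trans P≡ (cong (P ++_) R≡)) , z≤n , trans u≡ (sym (++-identityʳ (τ Q₁)))
  ... | inside Q₁ c Q₂ _ R≡ u≡ _ = Q₁ , 1 , (k , P , c ∷ Q₂ , trans P≡ (cong (P ++_) R≡)) , ≤-refl , u≡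

desubstitute : ∀ {v} → Occurs v → ∃[ z ] ∃[ i ] ∃[ j ] Occurs z × i ≤ 1 × j ≤ 1 × replicate i l0 ++ v ≡ τ z ++ replicate j l0
desubstitute {v} occ with occurs-cut [] v occ
... | k , _ , _ , boundary P₁ P₂ P≡ _ r≡
  with z , j , z-occ , j≤1 , v≡ ← desubstitute-prefix {k} P₁ P₂ P≡ r≡
  = z , 0 , j , z-occ , z≤n , j≤1 , v≡
... | k , _ , _ , inside P₁ c P₂ _ P≡ _ r≡
  with z , j , z-occ , j≤1 , v≡ ← desubstitute-prefix {k} P₁ (c ∷ P₂) P≡ (trans (cong (l0 ∷_) r≡) (sym (τ-∷ c P₂)))
  = z , 1 , j , z-occ , ≤-refl , j≤1 , v≡

desubstitution-counts : ∀ i v z j → replicate i l0 ++ v ≡ τ z ++ replicate j l0 →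
                        i + count l0 v ≡ length z + j × count l1 v ≡ count l0 z × count l2 v ≡ count l1 z
desubstitution-counts i v z j eq =
  cong proj₁ parikh≡ , trans (cong (λ p → proj₁ (proj₂ p)) parikh≡) (+-identityʳ _) , trans (cong (λ p → proj₂ (proj₂ p)) parikh≡) (+-identityʳ _)
  where
    open ≡-Reasoning
    parikh≡ : (i , 0 , 0) ⊕ parikh v ≡ (length z , count l0 z , count l1 z) ⊕ (j , 0 , 0)
    parikh≡ = begin
      (i , 0 , 0) ⊕ parikh v                                  ≡⟨ cong (_⊕ parikh v) (parikh-replicate-l0 i) ⟨
      parikh (replicate i l0) ⊕ parikh v                      ≡⟨ parikh-++ (replicate i l0) v ⟨
      parikh (replicate i l0 ++ v)                            ≡⟨ cong parikh eq ⟩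
      parikh (τ z ++ replicate j l0)                          ≡⟨ parikh-τ-++ z (replicate j l0) ⟩
      (length z , count l0 z , count l1 z) ⊕ parikh (replicate j l0) ≡⟨ cong (_ ⊕_) (parikh-replicate-l0 j) ⟩
      (length z , count l0 z , count l1 z) ⊕ (j , 0 , 0)      ∎

-- Counting letters in the factors of length |τ(w)0| + 1

≤-compensate : ∀ {a b c d} → a + b ≡ c + d → b ≤ d → c ≤ a
≤-compensate {a} {b} {c} {d} a+b≡c+d b≤d = +-cancelʳ-≤ d c a (≤-trans (≤-reflexive (sym a+b≡c+d)) (+-monoʳ-≤ a b≤d))

≼-⊕-letter : ∀ {b c d W0 W1 W2} x → (b , c , d) ≼ (W0 , W1 , W2) ⊕ parikh [ x ] →
             b ≤ suc W0 × c ≤ suc W1 × b + c ≤ suc (W0 + W1)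
≼-⊕-letter {b} {c} {_} {W0} {W1} l0 (b≤ , c≤ , _) =
  b≤′ , m≤n⇒m≤1+n c≤′ , +-mono-≤ b≤′ c≤′
  where
    b≤′ : b ≤ suc W0
    b≤′ = subst (b ≤_) (+-comm W0 1) b≤
    c≤′ : c ≤ W1
    c≤′ = subst (c ≤_) (+-identityʳ W1) c≤
≼-⊕-letter {b} {c} {_} {W0} {W1} l1 (b≤ , c≤ , _) =
  m≤n⇒m≤1+n b≤′ , c≤′ , subst (b + c ≤_) (+-suc W0 W1) (+-mono-≤ b≤′ c≤′)
  where
    b≤′ : b ≤ W0
    b≤′ = subst (b ≤_) (+-identityʳ W0) b≤
    c≤′ : c ≤ suc W1
    c≤′ = subst (c ≤_) (+-comm W1 1) c≤
≼-⊕-letter {b} {c} {_} {W0} {W1} l2 (b≤ , c≤ , _) =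
  m≤n⇒m≤1+n b≤′ , m≤n⇒m≤1+n c≤′ , m≤n⇒m≤1+n (+-mono-≤ b≤′ c≤′)
  where
    b≤′ : b ≤ W0
    b≤′ = subst (b ≤_) (+-identityʳ W0) b≤
    c≤′ : c ≤ W1
    c≤′ = subst (c ≤_) (+-identityʳ W1) c≤

-- In the next two bounds, 0^i v = τ(z) 0^j desubstitutes a factor v of length |τ(w)0| + 1, with
-- n = |w|, W0 = |w|₀, W1 = |w|₁, a = |v|₀, b = |z|₀, c = |z|₁ (s = b + c) and Z = |z|.
l0-count-bound : ∀ {n W a s Z i j} → i ≤ 1 → i + a ≡ Z + j → a + s ≡ suc n + suc W →
                 (Z ≤ suc n → s ≤ suc W) → suc n ≤ a
l0-count-bound {n} {a = a} {Z = Z} {i} {j} i≤1 i+a≡ sum≡ short with Z ≤? suc n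
... | yes Z≤ = ≤-compensate sum≡ (short Z≤)
... | no  Z≰ = ≤-pred (begin
  suc (suc n)  ≤⟨ ≰⇒> Z≰ ⟩
  Z            ≤⟨ m≤m+n Z j ⟩
  Z + j        ≡⟨ i+a≡ ⟨
  i + a        ≤⟨ +-monoˡ-≤ a i≤1 ⟩
  suc a        ∎)
  where open ≤-Reasoning

l1-l2-count-bound : ∀ {n W0 W1 a b c Z i j} → j ≤ 1 → i + a ≡ Z + j → a + (b + c) ≡ suc n + suc (W0 + W1) →
                    (suc n ≤ Z → W0 ≤ b × W1 ≤ c) → (Z ≤ suc n → b ≤ suc W0 × c ≤ suc W1) → W0 ≤ b × W1 ≤ c
l1-l2-count-bound {n} {W0} {W1} {a} {b} {c} {Z} {i} {j} j≤1 i+a≡ sum≡ long short with suc n ≤? Z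
... | yes n<Z = long n<Z
... | no  n≮Z = W0≤b , W1≤c
  where
    open ≤-Reasoning
    Z≤n : Z ≤ n
    Z≤n = ≤-pred (≰⇒> n≮Z)
    b≤ : b ≤ suc W0
    b≤ = proj₁ (short (≤-trans Z≤n (n≤1+n n)))
    c≤ : c ≤ suc W1
    c≤ = proj₂ (short (≤-trans Z≤n (n≤1+n n)))
    a≤ : a ≤ suc n
    a≤ = begin
      a      ≤⟨ m≤n+m a i ⟩
      i + a  ≡⟨ i+a≡ ⟩
      Z + j  ≤⟨ +-mono-≤ Z≤n j≤1 ⟩
      n + 1  ≡⟨ +-comm n 1 ⟩
      suc n  ∎
    many : suc (W0 + W1) ≤ b + c
    many = ≤-compensate (trans (+-comm (b + c) a) (trans sum≡ (+-comm (suc n) _))) a≤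
    W0≤b : W0 ≤ b
    W0≤b = +-cancelʳ-≤ (suc W1) W0 b (begin
      W0 + suc W1    ≡⟨ +-suc W0 W1 ⟩
      suc (W0 + W1)  ≤⟨ many ⟩
      b + c          ≤⟨ +-monoʳ-≤ b c≤ ⟩
      b + suc W1     ∎)
    W1≤c : W1 ≤ c
    W1≤c = +-cancelˡ-≤ (suc W0) W1 c (≤-trans many (+-monoˡ-≤ c b≤))

module _ (w : Word) (cover : ExtensionsCover w) where

  long-factor-≽ : ∀ {z} → Occurs z → suc (length w) ≤ length z → parikh w ≼ parikh z
  long-factor-≽ {z} occ w<z = ≼-trans (≼-++ʳ w [ proj₁ prefix-cover ]) (subst (_≼ parikh z) (proj₂ prefix-cover) y≼z)
    where
      y s : Word
      y = take (suc (length w)) z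
      s = drop (suc (length w)) z
      y++s≡z : y ++ s ≡ z
      y++s≡z = take++drop≡id (suc (length w)) z
      prefix-cover : ∃[ c ] parikh y ≡ parikh (w ++ [ c ])
      prefix-cover = cover y (occurs⇒isFactor (occurs-++⁻ˡ y s (subst Occurs (sym y++s≡z) occ)))
                             (trans (length-take (suc (length w)) z) (m≤n⇒m⊓n≡m w<z))
      y≼z : parikh y ≼ parikh z
      y≼z = subst (λ u → parikh y ≼ parikh u) y++s≡z (≼-++ʳ y s)

  short-factor-≼ : ∀ {z} → Occurs z → length z ≤ suc (length w) → ∃[ c ] parikh z ≼ parikh w ⊕ parikh [ c ]
  short-factor-≼ {z} occ z≤w with s , s-length , zs-occ ← occurs-extend (suc (length w) ∸ length z) occ
    with c , zs≡ ← cover (z ++ s) (occurs⇒isFactor zs-occ)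
                         (trans (length-++ z) (trans (cong (length z +_) s-length) (m+[n∸m]≡n z≤w)))
    = c , subst (parikh z ≼_) (trans zs≡ (parikh-++ w [ c ])) (≼-++ʳ z s)

  desubstituted-total : ∀ v z → length v ≡ suc (length (τ w ++ [ l0 ])) →
                        count l1 v ≡ count l0 z → count l2 v ≡ count l1 z →
                        count l0 v + (count l0 z + count l1 z) ≡ suc (length w) + suc (count l0 w + count l1 w)
  desubstituted-total v z v-length v₁≡ v₂≡ = begin
    count l0 v + (count l0 z + count l1 z)                     ≡⟨ cong₂ (λ p q → count l0 v + (p + q)) v₁≡ v₂≡ ⟨
    count l0 v + (count l1 v + count l2 v)                     ≡⟨ +-assoc (count l0 v) _ _ ⟨
    total (parikh v)                                           ≡⟨ length≡total v ⟨
    length v                                                   ≡⟨ v-length ⟩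
    suc (length (τ w ++ [ l0 ]))                               ≡⟨ cong suc (length≡total (τ w ++ [ l0 ])) ⟩
    suc (total (parikh (τ w ++ [ l0 ])))                       ≡⟨ cong (λ p → suc (total p)) (parikh-τ-++ w [ l0 ]) ⟩
    suc (length w + 1 + (count l0 w + 0) + (count l1 w + 0))   ≡⟨ regroup (length w) (count l0 w) (count l1 w) ⟩
    suc (length w) + suc (count l0 w + count l1 w)             ∎
    where
      open ≡-Reasoning
      regroup : ∀ n x y → suc (n + 1 + (x + 0) + (y + 0)) ≡ suc n + suc (x + y)
      regroup = solve-∀

  image-lower-bound : ∀ {v} → Occurs v → length v ≡ suc (length (τ w ++ [ l0 ])) → parikh (τ w ++ [ l0 ]) ≼ parikh v
  image-lower-bound {v} occ v-length
    with z , i , j , z-occ , i≤1 , j≤1 , eq ← desubstitute occ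
    with i+a≡ , v₁≡ , v₂≡ ← desubstitution-counts i v z j eq
    = subst (_≼ parikh v) (sym (parikh-τ-++ w [ l0 ])) (n+1≤v₀ , W₀≤v₁ , W₁≤v₂)
    where
      sum≡ : count l0 v + (count l0 z + count l1 z) ≡ suc (length w) + suc (count l0 w + count l1 w)
      sum≡ = desubstituted-total v z v-length v₁≡ v₂≡
      short : length z ≤ suc (length w) →
              count l0 z ≤ suc (count l0 w) × count l1 z ≤ suc (count l1 w) × count l0 z + count l1 z ≤ suc (count l0 w + count l1 w)
      short z≤w with c , z≼ ← short-factor-≼ z-occ z≤w = ≼-⊕-letter c z≼
      n+1≤v₀ : length w + 1 ≤ count l0 v
      n+1≤v₀ = subst (_≤ count l0 v) (+-comm 1 (length w)) (l0-count-bound i≤1 i+a≡ sum≡ (λ z≤w → proj₂ (proj₂ (short z≤w))))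
      W≤z : count l0 w ≤ count l0 z × count l1 w ≤ count l1 z
      W≤z = l1-l2-count-bound {a = count l0 v} {i = i} j≤1 i+a≡ sum≡
              (λ w<z → let (W₀≤ , W₁≤ , _) = long-factor-≽ z-occ w<z in W₀≤ , W₁≤)
              (λ z≤w → let (≤W₀ , ≤W₁ , _) = short z≤w in ≤W₀ , ≤W₁)
      W₀≤v₁ : count l0 w + 0 ≤ count l1 v
      W₀≤v₁ = subst₂ _≤_ (sym (+-identityʳ _)) (sym v₁≡) (proj₁ W≤z)
      W₁≤v₂ : count l1 w + 0 ≤ count l2 v
      W₁≤v₂ = subst₂ _≤_ (sym (+-identityʳ _)) (sym v₂≡) (proj₂ W≤z)

  image-cover : ExtensionsCover (τ w ++ [ l0 ])
  image-cover v v-factor v-length =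
    map₂ (λ v≡ → trans v≡ (sym (parikh-++ u₀ [ _ ]))) (≼-step (image-lower-bound (isFactor⇒occurs v-factor) v-length) total≡)
    where
      u₀ : Word
      u₀ = τ w ++ [ l0 ]
      total≡ : total (parikh v) ≡ suc (total (parikh u₀))
      total≡ = trans (sym (length≡total v)) (trans v-length (cong suc (length≡total u₀)))

image-extends : ∀ w → (∀ c → Occurs (w ++ [ c ])) → ExtendsByAll (τ w ++ [ l0 ])
image-extends w extends l0 =
  occurs⇒isFactor (subst Occurs (cong (_++ [ l0 ]) (τ-∷ʳ w l2)) (occurs-τ-∷ʳl0 (extends l2)))
image-extends w extends l1 =
  occurs⇒isFactor (subst Occurs (trans (τ-∷ʳ w l0) (sym (++-assoc (τ w) [ l0 ] [ l1 ]))) (occurs-τ (extends l0)))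
image-extends w extends l2 =
  occurs⇒isFactor (subst Occurs (trans (τ-∷ʳ w l1) (sym (++-assoc (τ w) [ l0 ] [ l2 ]))) (occurs-τ (extends l1)))

lemma5 : (n : ℕ) → (w : Word) → RightSpecial w → IsFactor w → length w ≡ n →
         ρ≡ (suc n) 3 → ρ≡ (length (τ w ++ l0 ∷ []) + 1) 3
lemma5 _ w (_ , _ , a≢b , wa , wb) _ refl ρ≡3 =
  subst (λ m → ρ≡ m 3) (+-comm 1 (length (τ w ++ [ l0 ])))
    (extensionsCover⇒ρ≡3 (τ w ++ [ l0 ]) (image-extends w w-extends) (image-cover w cover))
  where
    w-extends : ∀ c → Occurs (w ++ [ c ])
    w-extends = extends-by-all w (<-wellFounded (length w)) a≢b (isFactor⇒occurs wa) (isFactor⇒occurs wb)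
    cover : ExtensionsCover w
    cover = ρ≡3⇒extensionsCover w (λ c → occurs⇒isFactor (w-extends c)) ρ≡3
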